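{- Let $N \geq 2$ and $V=\{1,\ldots,N\}$. Let $\mathcal{A}'$ be the set of all simply connected acyclic digraphs on the vertex set $V$, and let $M'$ be the Markov chain on $\mathcal{A}'$ whose transitions are defined as follows: from state $X_t$, draw a pair $(i,j)$ uniformly at random from $V\times V$; (T'1) if $(i,j)$ is an arc of $X_t$, then (i) if $(i,j)$ is not disconnecting, set $X_{t+1}=X_t\setminus\{(i,j)\}$, and (ii) if $(i,j)$ is disconnecting, set $X_{t+1}=(X_t\setminus\{(i,j)\})\cup\{(j,i)\}$; (T2) if $(i,j)$ is not an arc of $X_t$, then (i) set $X_{t+1}=X_t\cup\{(i,j)\}$ if the resulting digraph is acyclic, and (ii) otherwise set $X_{t+1}=X_t$. Then $M'$ is irreducible: for any two simply connected acyclic digraphs $G,H\in\mathcal{A}'$ there exists a sequence of transitions $G=G_0\to G_1\to\cdots\to G_p=H$ of $M'$ with $p\geq 1$ and all $G_i\in\mathcal{A}'$. Moreover, such a sequence exists with length $p$ at most $(N+7)(N-3/2)$.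
   Context: A digraph on $V$ is identified with its set of arcs (ordered pairs of vertices). It is acyclic if it contains no directed circuit $v_0,v_1,\ldots,v_k=v_0$ with each $(v_i,v_{i+1})$ an arc. It is simply connected if its underlying undirected graph (forgetting orientations) is connected. An arc of a simply connected digraph is disconnecting if removing it yields a digraph that is not simply connected. A transition $X\to Y$ of $M'$ means that $Y$ is obtained from $X$ by one application of the rules above for some pair $(i,j)$. -}

module Defs where

open import Data.Nat using (ℕ; zero; suc)
open import Data.Fin using (Fin; _≟_)
open import Data.Bool using (Bool; true; false; _∧_; if_then_else_)
open import Data.Product using (Σ; _×_; ∃; ∃-syntax)
open import Data.Sum using (_⊎_)
open import Relation.Nullary using (¬_)
open import Relation.Nullary.Decidable using (⌊_⌋)
open import Relation.Binary.PropositionalEquality using (_≡_)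
open import Relation.Binary.Construct.Closure.ReflexiveTransitive using (Star)

-- A digraph on V = Fin N, identified with its set of arcs,
-- given by the (decidable) characteristic function of the arc set.
Digraph : ℕ → Set
Digraph N = Fin N → Fin N → Bool

Arc : ∀ {N} → Digraph N → Fin N → Fin N → Set
Arc G i j = G i j ≡ true

_≐_ : ∀ {N} → Digraph N → Digraph N → Set
G ≐ H = ∀ a b → G a b ≡ H a b

remove : ∀ {N} → Digraph N → Fin N → Fin N → Digraph N
remove X i j a b = if ⌊ a ≟ i ⌋ ∧ ⌊ b ≟ j ⌋ then false else X a b

add : ∀ {N} → Digraph N → Fin N → Fin N → Digraph N
add X i j a b = if ⌊ a ≟ i ⌋ ∧ ⌊ b ≟ j ⌋ then true else X a b

data DWalk {N} (G : Digraph N) : Fin N → Fin N → ℕ → Set where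
  here : ∀ {v} → DWalk G v v zero
  there : ∀ {u w v k} → Arc G u w → DWalk G w v k → DWalk G u v (suc k)

Acyclic : ∀ {N} → Digraph N → Set
Acyclic G = ∀ v k → ¬ DWalk G v v (suc k)

UAdj : ∀ {N} → Digraph N → Fin N → Fin N → Set
UAdj G u v = Arc G u v ⊎ Arc G v u

SimplyConnected : ∀ {N} → Digraph N → Set
SimplyConnected G = ∀ u v → Star (UAdj G) u v

InA' : ∀ {N} → Digraph N → Set
InA' G = SimplyConnected G × Acyclic G

Disconnecting : ∀ {N} → Digraph N → Fin N → Fin N → Set
Disconnecting X i j = ¬ SimplyConnected (remove X i j)

TransVia : ∀ {N} → Digraph N → Fin N → Fin N → Digraph N → Set
TransVia X i j Y =
    (Arc X i j × ¬ Disconnecting X i j × Y ≐ remove X i j)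
  ⊎ (Arc X i j × Disconnecting X i j × Y ≐ add (remove X i j) j i)
  ⊎ (¬ Arc X i j × Acyclic (add X i j) × Y ≐ add X i j)
  ⊎ (¬ Arc X i j × ¬ Acyclic (add X i j) × Y ≐ X)

Trans : ∀ {N} → Digraph N → Digraph N → Set
Trans X Y = ∃[ i ] ∃[ j ] TransVia X i j Y

data Reach {N} : ℕ → Digraph N → Digraph N → Set where
  last : ∀ {X Y} → InA' X → InA' Y → Trans X Y → Reach 1 X Y
  cons : ∀ {p X Y Z} → InA' X → Trans X Y → Reach p Y Z → Reach (suc p) X Z

module Submission where

-- Every acyclic digraph has a source c. Adding the arcs c → v one at a time keeps it acyclic,
-- since nothing enters c; once the out-star star c is present, every other arc can be deleted
-- without disconnecting. Acyclicity leaves at most one arc between any two vertices, so star c is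
-- reached in at most (N − 1) + (N − 1)(N − 2)/2 transitions. Two out-stars star c and star d are
-- joined in 2N − 3 transitions: reversing the then disconnecting arc c → d makes d a source, and
-- the same procedure recentres the digraph at d. Transitions between states of 𝒜' can be undone,
-- so G → star c → star d → H, with 2 (2 ((N − 1) + (N − 1)(N − 2)/2) + 2N − 3) ≤ (N + 7)(2N − 3).

open import Defs
open import Data.Nat using (ℕ; zero; suc; z≤n; s≤s; _≤_; _*_; _+_; _∸_)
open import Data.Nat.Properties
  using (+-comm; +-mono-≤; n<1+n; m≤n⇒∃[o]m+o≡n; m≤m+n; m+n∸m≡n; *-monoʳ-≤; ≤-trans;
         module ≤-Reasoning)
open import Data.Nat.Tactic.RingSolver using (solve-∀)
open import Data.Bool using (true; false; not; _∧_; if_then_else_)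
open import Data.Bool.Properties using (¬-not) renaming (_≟_ to _≟ᵇ_)
open import Data.Fin using (Fin; zero; suc; _≟_; toℕ; punchIn; punchOut)
open import Data.Fin.Properties
  using (any?; all?; ¬∀⟶∃¬; pigeonhole; punchInᵢ≢i; punchIn-punchOut; punchOut-injective)
open import Data.Product using (_×_; _,_; proj₁; proj₂; ∃-syntax)
import Data.Product as Product
open import Data.Sum using (_⊎_; inj₁; inj₂)
import Data.Sum as Sum
open import Data.List using (List; []; _∷_; length; map; allFin)
import Data.List as List
open import Data.List.Properties using (length-map; length-++; length-tabulate)
open import Data.List.Relation.Unary.All as All using (All; []; _∷_; universal)
open import Data.List.Relation.Unary.All.Properties using (map⁺)
open import Data.List.Relation.Unary.Any using (here; there)
open import Data.List.Membership.Propositional using (_∈_)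
open import Data.List.Membership.Propositional.Properties using (∈-map⁺; ∈-++⁺ˡ; ∈-++⁺ʳ; ∈-allFin)
open import Function using (_∘_; _∘′_)
open import Relation.Nullary using (¬_; contradiction; yes; no; Dec; ¬?)
open import Relation.Nullary.Decidable using (⌊_⌋; _×-dec_; decidable-stable; toSum)
open import Relation.Binary.PropositionalEquality
  using (_≡_; _≢_; refl; sym; trans; cong; cong₂; subst; subst₂; module ≡-Reasoning)
open import Relation.Binary.Construct.Closure.ReflexiveTransitive as Star using (Star; ε; _◅_; _◅◅_)

private
  variable
    N k l n : ℕ
    X X′ Y Y′ Z : Digraph N
    a b c d i j u v : Fin N
    vs : List (Fin N)
    ps : List (Fin N × Fin N)

record _⊆_ (X Y : Digraph N) : Set where
  constructor subgraph
  field
    ⊆-arc : ∀ {a b} → Arc X a b → Arc Y a b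

open _⊆_

⊆-refl : X ⊆ X
⊆-refl = subgraph λ ab → ab

⊆-trans : X ⊆ Y → Y ⊆ Z → X ⊆ Z
⊆-trans X⊆Y Y⊆Z = subgraph (⊆-arc Y⊆Z ∘ ⊆-arc X⊆Y)

arc? : ∀ (X : Digraph N) a b → Dec (Arc X a b)
arc? X a b = X a b ≟ᵇ true

≐-refl : X ≐ X
≐-refl a b = refl

≐-sym : X ≐ Y → Y ≐ X
≐-sym X≐Y a b = sym (X≐Y a b)

≐-trans : X ≐ Y → Y ≐ Z → X ≐ Z
≐-trans X≐Y Y≐Z a b = trans (X≐Y a b) (Y≐Z a b)

≐⇒⊆ : X ≐ Y → X ⊆ Y
≐⇒⊆ X≐Y = subgraph λ {a} {b} → trans (sym (X≐Y a b))

⊆-antisym : X ⊆ Y → Y ⊆ X → X ≐ Y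
⊆-antisym {X = X} {Y = Y} X⊆Y Y⊆X a b with X a b in Xab | Y a b in Yab
... | true  | true  = refl
... | false | false = refl
... | true  | false = contradiction (trans (sym (⊆-arc X⊆Y Xab)) Yab) λ ()
... | false | true  = contradiction (trans (sym (⊆-arc Y⊆X Yab)) Xab) λ ()

⊆-¬Arc : X ⊆ Y → ¬ Arc Y a b → ¬ Arc X a b
⊆-¬Arc X⊆Y ¬Yab = ¬Yab ∘ ⊆-arc X⊆Y

UAdj-mono : X ⊆ Y → UAdj X a b → UAdj Y a b
UAdj-mono X⊆Y = Sum.map (⊆-arc X⊆Y) (⊆-arc X⊆Y)

SimplyConnected-mono : X ⊆ Y → SimplyConnected X → SimplyConnected Y
SimplyConnected-mono X⊆Y conn u v = Star.map (λ {a b} → UAdj-mono {a = a} {b = b} X⊆Y) (conn u v)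

DWalk-mono : X ⊆ Y → DWalk X u v k → DWalk Y u v k
DWalk-mono X⊆Y here         = here
DWalk-mono X⊆Y (there uw w) = there (⊆-arc X⊆Y uw) (DWalk-mono X⊆Y w)

Acyclic-antimono : X ⊆ Y → Acyclic Y → Acyclic X
Acyclic-antimono X⊆Y acyclic v k = acyclic v k ∘′ DWalk-mono X⊆Y

InA'-resp : X ≐ Y → InA' X → InA' Y
InA'-resp X≐Y (conn , acyclic) =
  SimplyConnected-mono (≐⇒⊆ X≐Y) conn , Acyclic-antimono (≐⇒⊆ (≐-sym X≐Y)) acyclic

Acyclic⇒¬loop : Acyclic X → ¬ Arc X a a
Acyclic⇒¬loop acyclic aa = acyclic _ 0 (there aa here)

Acyclic⇒¬2-cycle : Acyclic X → Arc X a b → ¬ Arc X b a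
Acyclic⇒¬2-cycle acyclic ab ba = acyclic _ 1 (there ab (there ba here))

private
  pair-test-≢ : ¬ (a ≡ i × b ≡ j) → (⌊ a ≟ i ⌋ ∧ ⌊ b ≟ j ⌋) ≡ false
  pair-test-≢ {a = a} {i = i} {b = b} {j = j} ne with a ≟ i | b ≟ j
  ... | yes a≡i | yes b≡j = contradiction (a≡i , b≡j) ne
  ... | yes _   | no _    = refl
  ... | no _    | _       = refl

  pair-test-≡ : ∀ (i j : Fin N) → (⌊ i ≟ i ⌋ ∧ ⌊ j ≟ j ⌋) ≡ true
  pair-test-≡ i j with i ≟ i | j ≟ j
  ... | yes _  | yes _  = refl
  ... | yes _  | no j≢j = contradiction refl j≢j
  ... | no i≢i | _      = contradiction refl i≢i

remove-≢ : ∀ (X : Digraph N) → ¬ (a ≡ i × b ≡ j) → remove X i j a b ≡ X a b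
remove-≢ {a = a} {b = b} X ne = cong (λ t → if t then false else X a b) (pair-test-≢ ne)

add-≢ : ∀ (X : Digraph N) → ¬ (a ≡ i × b ≡ j) → add X i j a b ≡ X a b
add-≢ {a = a} {b = b} X ne = cong (λ t → if t then true else X a b) (pair-test-≢ ne)

remove-≡ : ∀ (X : Digraph N) i j → ¬ Arc (remove X i j) i j
remove-≡ X i j ij =
  contradiction (trans (sym (cong (λ t → if t then false else X i j) (pair-test-≡ i j))) ij) λ ()

add-≡ : ∀ (X : Digraph N) i j → Arc (add X i j) i j
add-≡ X i j = cong (λ t → if t then true else X i j) (pair-test-≡ i j)

remove-⊆ : remove X i j ⊆ X
remove-⊆ {X = X} {i = i} {j = j} = subgraph arcs
  where
    arcs : Arc (remove X i j) a b → Arc X a b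
    arcs {a = a} {b = b} ab with (a ≟ i) ×-dec (b ≟ j)
    ... | yes (refl , refl) = contradiction ab (remove-≡ X i j)
    ... | no ne             = trans (sym (remove-≢ X ne)) ab

⊆-add : X ⊆ add X i j
⊆-add {X = X} {i = i} {j = j} = subgraph arcs
  where
    arcs : Arc X a b → Arc (add X i j) a b
    arcs {a = a} {b = b} ab with (a ≟ i) ×-dec (b ≟ j)
    ... | yes (refl , refl) = add-≡ X i j
    ... | no ne             = trans (add-≢ X ne) ab

remove-cong : X ≐ Y → remove X i j ≐ remove Y i j
remove-cong {i = i} {j = j} X≐Y a b = cong (if ⌊ a ≟ i ⌋ ∧ ⌊ b ≟ j ⌋ then false else_) (X≐Y a b)

add-cong : X ≐ Y → add X i j ≐ add Y i j
add-cong {i = i} {j = j} X≐Y a b = cong (if ⌊ a ≟ i ⌋ ∧ ⌊ b ≟ j ⌋ then true else_) (X≐Y a b)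

remove-absent : ¬ Arc X i j → remove X i j ≐ X
remove-absent {X = X} {i = i} {j = j} ¬ij = ⊆-antisym remove-⊆ (subgraph arcs)
  where
    arcs : Arc X a b → Arc (remove X i j) a b
    arcs {a = a} {b = b} ab with (a ≟ i) ×-dec (b ≟ j)
    ... | yes (refl , refl) = contradiction ab ¬ij
    ... | no ne             = trans (remove-≢ X ne) ab

add-present : Arc X i j → add X i j ≐ X
add-present {X = X} {i = i} {j = j} ij = ⊆-antisym (subgraph arcs) ⊆-add
  where
    arcs : Arc (add X i j) a b → Arc X a b
    arcs {a = a} {b = b} ab with (a ≟ i) ×-dec (b ≟ j)
    ... | yes (refl , refl) = ij
    ... | no ne             = trans (sym (add-≢ X ne)) ab

add-remove : Arc X i j → add (remove X i j) i j ≐ X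
add-remove {X = X} {i = i} {j = j} ij a b with (a ≟ i) ×-dec (b ≟ j)
... | yes (refl , refl) = trans (add-≡ (remove X i j) i j) (sym ij)
... | no ne             = trans (add-≢ (remove X i j) ne) (remove-≢ X ne)

remove-add : ¬ Arc X i j → remove (add X i j) i j ≐ X
remove-add {X = X} {i = i} {j = j} ¬ij a b with (a ≟ i) ×-dec (b ≟ j)
... | yes (refl , refl) = trans (¬-not (remove-≡ (add X i j) i j)) (sym (¬-not ¬ij))
... | no ne             = trans (remove-≢ (add X i j) ne) (add-≢ X ne)

-- Transitions and paths of M′

Disconnecting-resp : X ≐ X′ → Disconnecting X i j → Disconnecting X′ i j
Disconnecting-resp X≐X′ disc = disc ∘ SimplyConnected-mono (≐⇒⊆ (remove-cong (≐-sym X≐X′)))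

Trans-respˡ : X ≐ X′ → Trans X Y → Trans X′ Y
Trans-respˡ e (i , j , inj₁ (ij , ¬disc , Y≐)) =
  i , j , inj₁ (⊆-arc (≐⇒⊆ e) ij , ¬disc ∘ Disconnecting-resp (≐-sym e) , ≐-trans Y≐ (remove-cong e))
Trans-respˡ e (i , j , inj₂ (inj₁ (ij , disc , Y≐))) =
  i , j , inj₂ (inj₁ (⊆-arc (≐⇒⊆ e) ij , Disconnecting-resp e disc ,
                      ≐-trans Y≐ (add-cong (remove-cong e))))
Trans-respˡ e (i , j , inj₂ (inj₂ (inj₁ (¬ij , acyclic , Y≐)))) =
  i , j , inj₂ (inj₂ (inj₁ (¬ij ∘ ⊆-arc (≐⇒⊆ (≐-sym e)) ,
                            Acyclic-antimono (≐⇒⊆ (add-cong (≐-sym e))) acyclic ,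
                            ≐-trans Y≐ (add-cong e))))
Trans-respˡ e (i , j , inj₂ (inj₂ (inj₂ (¬ij , ¬acyclic , Y≐)))) =
  i , j , inj₂ (inj₂ (inj₂ (¬ij ∘ ⊆-arc (≐⇒⊆ (≐-sym e)) ,
                            ¬acyclic ∘ Acyclic-antimono (≐⇒⊆ (add-cong e)) ,
                            ≐-trans Y≐ e)))

Trans-respʳ : Y ≐ Y′ → Trans X Y → Trans X Y′
Trans-respʳ {Y = Y} {Y′ = Y′} e (i , j , t) =
  i , j , Sum.map retarget (Sum.map retarget (Sum.map retarget retarget)) t
  where
    retarget : {P Q : Set} {W : Digraph _} → P × Q × Y ≐ W → P × Q × Y′ ≐ W
    retarget (p , q , Y≐W) = p , q , ≐-trans (≐-sym e) Y≐W

Trans-sym : InA' X → Trans X Y → Trans Y X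
Trans-sym {X = X} {Y = Y} (_ , acyclic) (i , j , inj₁ (ij , _ , Y≐)) =
  i , j , inj₂ (inj₂ (inj₁ (remove-≡ X i j ∘ ⊆-arc (≐⇒⊆ Y≐) ,
                            Acyclic-antimono (≐⇒⊆ addY≐X) acyclic ,
                            ≐-sym addY≐X)))
  where
    addY≐X : add Y i j ≐ X
    addY≐X = ≐-trans (add-cong Y≐) (add-remove ij)
Trans-sym {X = X} {Y = Y} (_ , acyclic) (i , j , inj₂ (inj₁ (ij , disc , Y≐))) =
  j , i , inj₂ (inj₁ (⊆-arc (≐⇒⊆ (≐-sym Y≐)) (add-≡ (remove X i j) j i) ,
                      disc ∘ SimplyConnected-mono (≐⇒⊆ removeY≐) ,
                      ≐-sym X≐))
  where
    ¬ji : ¬ Arc (remove X i j) j i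
    ¬ji = ⊆-¬Arc (remove-⊆ {X = X}) (Acyclic⇒¬2-cycle acyclic ij)
    removeY≐ : remove Y j i ≐ remove X i j
    removeY≐ = ≐-trans (remove-cong Y≐) (remove-add {X = remove X i j} ¬ji)
    X≐ : add (remove Y j i) i j ≐ X
    X≐ = ≐-trans (add-cong removeY≐) (add-remove ij)
Trans-sym {X = X} {Y = Y} (conn , _) (i , j , inj₂ (inj₂ (inj₁ (¬ij , _ , Y≐)))) =
  i , j , inj₁ (⊆-arc (≐⇒⊆ (≐-sym Y≐)) (add-≡ X i j) ,
                (λ disc → disc (SimplyConnected-mono (≐⇒⊆ X≐) conn)) ,
                X≐)
  where
    X≐ : X ≐ remove Y i j
    X≐ = ≐-sym (≐-trans (remove-cong Y≐) (remove-add {X = X} ¬ij))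
Trans-sym _ (i , j , inj₂ (inj₂ (inj₂ (¬ij , ¬acyclic , Y≐)))) =
  i , j , inj₂ (inj₂ (inj₂ (¬ij ∘ ⊆-arc (≐⇒⊆ Y≐) ,
                            ¬acyclic ∘ Acyclic-antimono (≐⇒⊆ (add-cong (≐-sym Y≐))) ,
                            ≐-sym Y≐)))

-- Proposing the loop (v , v) is an idle step by rule (T2)(ii).
Trans-refl : {X Y : Digraph N} → Fin N → Acyclic X → X ≐ Y → Trans X Y
Trans-refl {X = X} v acyclic X≐Y =
  v , v , inj₂ (inj₂ (inj₂ (Acyclic⇒¬loop acyclic ,
                            (λ acyclic′ → Acyclic⇒¬loop acyclic′ (add-≡ X v v)) ,
                            ≐-sym X≐Y)))

data Path {N : ℕ} : ℕ → Digraph N → Digraph N → Set where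
  stay : X ≐ Y → Path 0 X Y
  step : InA' X → InA' Y → Trans X Y → Path k Y Z → Path (suc k) X Z

Path-respˡ : X ≐ X′ → Path k X Y → Path k X′ Y
Path-respˡ e (stay X≐Y)           = stay (≐-trans (≐-sym e) X≐Y)
Path-respˡ e (step inX inY t p)   = step (InA'-resp e inX) inY (Trans-respˡ e t) p

Path-respʳ : Y ≐ Y′ → Path k X Y → Path k X Y′
Path-respʳ e (stay X≐Y)         = stay (≐-trans X≐Y e)
Path-respʳ e (step inX inY t p) = step inX inY t (Path-respʳ e p)

_++_ : Path k X Y → Path l Y Z → Path (k + l) X Z
stay X≐Y         ++ q = Path-respˡ (≐-sym X≐Y) q
step inX inY t p ++ q = step inX inY t (p ++ q)

Path-reverse : Path k X Y → Path k Y X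
Path-reverse (stay X≐Y) = stay (≐-sym X≐Y)
Path-reverse {X = X} {Y = Y} (step {k = k} inX inZ t p) =
  subst (λ k → Path k Y X) (+-comm k 1) (Path-reverse p ++ step inZ inX (Trans-sym inX t) (stay ≐-refl))

Path-target : InA' X → Path k X Y → InA' Y
Path-target inX (stay X≐Y)       = InA'-resp X≐Y inX
Path-target _   (step _ inY _ p) = Path-target inY p

Path⇒Reach : Path (suc k) X Y → Reach (suc k) X Y
Path⇒Reach (step inX inY t (stay Y≐Z))        = last inX (InA'-resp Y≐Z inY) (Trans-respʳ Y≐Z t)
Path⇒Reach (step inX inY t p@(step _ _ _ _)) = cons inX t (Path⇒Reach p)

infix 4 _⇝[_]_

_⇝[_]_ : Digraph N → ℕ → Digraph N → Set
X ⇝[ k ] Y = ∃[ l ] (l ≤ k × Path l X Y)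

≐⇒⇝ : X ≐ Y → X ⇝[ k ] Y
≐⇒⇝ X≐Y = 0 , z≤n , stay X≐Y

⇝-single : InA' X → InA' Y → Trans X Y → X ⇝[ 1 ] Y
⇝-single inX inY t = 1 , s≤s z≤n , step inX inY t (stay ≐-refl)

⇝-trans : X ⇝[ k ] Y → Y ⇝[ l ] Z → X ⇝[ k + l ] Z
⇝-trans (_ , k′≤k , p) (_ , l′≤l , q) = _ , +-mono-≤ k′≤k l′≤l , p ++ q

⇝-sym : X ⇝[ k ] Y → Y ⇝[ k ] X
⇝-sym (_ , l≤k , p) = _ , l≤k , Path-reverse p

⇝-respʳ : Y ≐ Y′ → X ⇝[ k ] Y → X ⇝[ k ] Y′
⇝-respʳ e (_ , l≤k , p) = _ , l≤k , Path-respʳ e p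

⇝-target : InA' X → X ⇝[ k ] Y → InA' Y
⇝-target inX (_ , _ , p) = Path-target inX p

⇝⇒Reach : {X Y : Digraph N} → Fin N → InA' X → 1 ≤ k → X ⇝[ k ] Y →
          ∃[ p ] (1 ≤ p × p ≤ k × Reach p X Y)
⇝⇒Reach v inX 1≤k (zero , _ , stay X≐Y) =
  1 , s≤s z≤n , 1≤k , last inX (InA'-resp X≐Y inX) (Trans-refl v (proj₂ inX) X≐Y)
⇝⇒Reach v inX 1≤k (suc l , 1+l≤k , p) = suc l , s≤s z≤n , 1+l≤k , Path⇒Reach p

add-move : InA' X → InA' (add X i j) → X ⇝[ 1 ] add X i j
add-move {X = X} {i = i} {j = j} inX inY with arc? X i j
... | yes ij  = ≐⇒⇝ (≐-sym (add-present ij))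
... | no ¬ij  = ⇝-single inX inY (i , j , inj₂ (inj₂ (inj₁ (¬ij , proj₂ inY , ≐-refl))))

remove-move : InA' X → InA' (remove X i j) → X ⇝[ 1 ] remove X i j
remove-move {X = X} {i = i} {j = j} inX inY with arc? X i j
... | yes ij  = ⇝-single inX inY (i , j , inj₁ (ij , (λ disc → disc (proj₁ inY)) , ≐-refl))
... | no ¬ij  = ≐⇒⇝ (≐-sym (remove-absent ¬ij))

clear : Digraph N → Fin N → Fin N → Digraph N
clear X a b = remove (remove X a b) b a

clear-move : InA' X → InA' (clear X a b) → X ⇝[ 1 ] clear X a b
clear-move {X = X} {a = a} {b = b} inX inY with arc? X a b
... | yes ab  = ⇝-respʳ (≐-sym clear≐) (remove-move inX (InA'-resp clear≐ inY))
  where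
    clear≐ : clear X a b ≐ remove X a b
    clear≐ = remove-absent (⊆-¬Arc (remove-⊆ {X = X}) (Acyclic⇒¬2-cycle (proj₂ inX) ab))
... | no ¬ab  = ⇝-respʳ (≐-sym clear≐) (remove-move inX (InA'-resp clear≐ inY))
  where
    clear≐ : clear X a b ≐ remove X b a
    clear≐ = remove-cong (remove-absent ¬ab)

-- Sources and out-stars

Source : Fin N → Digraph N → Set
Source c X = ∀ a → ¬ Arc X a c

DWalk-lastArc : DWalk X u v (suc k) → ∃[ a ] Arc X a v
DWalk-lastArc (there {u = u} uv here)   = u , uv
DWalk-lastArc (there _ w@(there _ _)) = DWalk-lastArc w

DWalk-avoiding : Source c Y → (∀ {a b} → a ≢ c → Arc Y a b → Arc X a b) →
                 u ≢ c → DWalk Y u v k → DWalk X u v k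
DWalk-avoiding source agree u≢c here         = here
DWalk-avoiding source agree u≢c (there uw w) =
  there (agree u≢c uw) (DWalk-avoiding source agree (λ { refl → source _ uw }) w)

Acyclic-source-extension : Source c Y → (∀ {a b} → a ≢ c → Arc Y a b → Arc X a b) →
                           Acyclic X → Acyclic Y
Acyclic-source-extension {c = c} source agree acyclic v k w with v ≟ c
... | yes refl = source _ (proj₂ (DWalk-lastArc w))
... | no v≢c   = acyclic v k (DWalk-avoiding source agree v≢c w)

predecessors⇒¬Acyclic : {X : Digraph N} → Fin N → (pred : Fin N → Fin N) → (∀ v → Arc X (pred v) v) →
                        ¬ Acyclic X
predecessors⇒¬Acyclic {N = N} {X = X} v₀ pred arc acyclic =
  let w , o , closed = circuit in acyclic w o closed
  where
    ancestor : ℕ → Fin N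
    ancestor zero    = v₀
    ancestor (suc k) = pred (ancestor k)

    descent : ∀ i k → DWalk X (ancestor (k + i)) (ancestor i) k
    descent i zero    = here
    descent i (suc k) = there (arc _) (descent i k)

    circuit : ∃[ w ] ∃[ o ] DWalk X w w (suc o)
    circuit with i , j , i<j , same ← pigeonhole (n<1+n N) (ancestor ∘ toℕ)
            with o , i+1+o≡j ← m≤n⇒∃[o]m+o≡n i<j
      = ancestor (toℕ j) , o
      , subst₂ (λ u w → DWalk X u w (suc o))
               (cong ancestor (trans (cong suc (+-comm o (toℕ i))) i+1+o≡j)) same
               (descent (toℕ i) (suc o))

acyclic⇒source : {X : Digraph N} → Fin N → Acyclic X → ∃[ c ] Source c X
acyclic⇒source {N = N} {X = X} v₀ acyclic with any? (λ c → all? (λ a → ¬? (arc? X a c)))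
... | yes source = source
... | no ¬source = contradiction acyclic (predecessors⇒¬Acyclic v₀ (proj₁ ∘ entered) (proj₂ ∘ entered))
  where
    entered : ∀ c → ∃[ a ] Arc X a c
    entered c = Product.map₂ (λ {a} → decidable-stable (arc? X a c))
                  (¬∀⟶∃¬ N _ (λ a → ¬? (arc? X a c)) (¬source ∘ (c ,_)))

star : Fin N → Digraph N
star c a b = ⌊ a ≟ c ⌋ ∧ not ⌊ b ≟ c ⌋

star-arc : v ≢ c → Arc (star c) c v
star-arc {v = v} {c = c} v≢c with c ≟ c | v ≟ c
... | yes _   | no _     = refl
... | yes _   | yes v≡c  = contradiction v≡c v≢c
... | no c≢c  | _        = contradiction refl c≢c

star-arc⁻ : Arc (star c) a b → a ≡ c × b ≢ c
star-arc⁻ {c = c} {a = a} {b = b} ab with a ≟ c | b ≟ c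
... | yes a≡c | no b≢c = a≡c , b≢c

star-source : Source c (star c)
star-source {c = c} a ac = proj₂ (star-arc⁻ {c = c} {a = a} ac) refl

star-acyclic : Acyclic (star c)
star-acyclic {c = c} v k w@(there vw _) with refl ← proj₁ (star-arc⁻ {c = c} {a = v} vw) =
  star-source {c = c} _ (proj₂ (DWalk-lastArc w))

hub⇒SimplyConnected : (∀ {v} → v ≢ c → UAdj X c v) → SimplyConnected X
hub⇒SimplyConnected {c = c} {X = X} hub u v = Star.reverse Sum.swap (fromHub u) ◅◅ fromHub v
  where
    fromHub : ∀ v → Star (UAdj X) c v
    fromHub v with v ≟ c
    ... | yes refl = ε
    ... | no v≢c   = hub v≢c ◅ ε

isolated⇒¬SimplyConnected : (∀ a → ¬ Arc X a d) → (∀ b → ¬ Arc X d b) → u ≢ d → ¬ SimplyConnected X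
isolated⇒¬SimplyConnected {d = d} {u = u} no-in no-out u≢d conn with conn d u
... | ε            = u≢d refl
... | inj₁ db ◅ _ = no-out _ db
... | inj₂ ad ◅ _ = no-in _ ad

star⊆ : (∀ {v} → v ≢ c → Arc X c v) → star c ⊆ X
star⊆ {c = c} {X = X} out = subgraph λ {a} {b} → arcs {a} {b}
  where
    arcs : Arc (star c) a b → Arc X a b
    arcs {a = a} ab with refl , b≢c ← star-arc⁻ {c = c} {a = a} ab = out b≢c

star⊆⇒SimplyConnected : star c ⊆ X → SimplyConnected X
star⊆⇒SimplyConnected {c = c} star⊆X = hub⇒SimplyConnected (inj₁ ∘ ⊆-arc star⊆X ∘ star-arc {c = c})

InA'-star : InA' (star c)
InA'-star = star⊆⇒SimplyConnected ⊆-refl , star-acyclic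

≐-star : star c ⊆ X → (∀ {a b} → Arc X a b → a ≡ c) → Acyclic X → X ≐ star c
≐-star {c = c} {X = X} star⊆X out acyclic = ⊆-antisym (subgraph arcs) star⊆X
  where
    arcs : Arc X a b → Arc (star c) a b
    arcs ab with refl ← out ab = star-arc {c = c} λ { refl → Acyclic⇒¬loop acyclic ab }

-- Recentring an acyclic digraph at a source

addOutArcs : Digraph N → Fin N → List (Fin N) → Digraph N
addOutArcs X c []       = X
addOutArcs X c (v ∷ vs) = addOutArcs (add X c v) c vs

add-keeps-source : Source c X → v ≢ c → Source c (add X c v)
add-keeps-source {X = X} source v≢c a =
  source a ∘ trans (sym (add-≢ X λ (_ , c≡v) → v≢c (sym c≡v)))

add-out-agrees : a ≢ c → Arc (add X c v) a b → Arc X a b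
add-out-agrees {X = X} a≢c = trans (sym (add-≢ X λ (a≡c , _) → a≢c a≡c))

InA'-add-out : InA' X → Source c X → v ≢ c → InA' (add X c v)
InA'-add-out {X = X} (conn , acyclic) source v≢c =
  SimplyConnected-mono ⊆-add conn ,
  Acyclic-source-extension (add-keeps-source {X = X} source v≢c) (add-out-agrees {X = X}) acyclic

addOutArcs-⇝ : InA' X → Source c X → All (_≢ c) vs → X ⇝[ length vs ] addOutArcs X c vs
addOutArcs-⇝ inX source []           = ≐⇒⇝ ≐-refl
addOutArcs-⇝ {X = X} {c = c} {vs = v ∷ vs} inX source (v≢c ∷ vs≢c) =
  ⇝-trans (add-move inX inX′) (addOutArcs-⇝ inX′ (add-keeps-source {X = X} source v≢c) vs≢c)
  where
    inX′ : InA' (add X c v)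
    inX′ = InA'-add-out inX source v≢c

addOutArcs-⊇ : X ⊆ addOutArcs X c vs
addOutArcs-⊇ {vs = []}    = ⊆-refl
addOutArcs-⊇ {vs = _ ∷ vs} = ⊆-trans ⊆-add (addOutArcs-⊇ {vs = vs})

addOutArcs-∈ : v ∈ vs → Arc (addOutArcs X c vs) c v
addOutArcs-∈ {v = v} {vs = _ ∷ vs} {X = X} {c = c} (here refl) =
  ⊆-arc (addOutArcs-⊇ {vs = vs}) (add-≡ X c v)
addOutArcs-∈ {X = X} {c = c} (there {x = w} v∈vs) = addOutArcs-∈ {X = add X c w} v∈vs

addOutArcs-≢ : a ≢ c → Arc (addOutArcs X c vs) a b → Arc X a b
addOutArcs-≢ {vs = []}                     a≢c = λ ab → ab
addOutArcs-≢ {c = c} {X = X} {vs = v ∷ vs} a≢c =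
  add-out-agrees {X = X} a≢c ∘ addOutArcs-≢ {X = add X c v} {vs = vs} a≢c

Avoids : Fin N → Fin N × Fin N → Set
Avoids c (a , b) = a ≢ c × b ≢ c

clearPairs : Digraph N → List (Fin N × Fin N) → Digraph N
clearPairs X []             = X
clearPairs X ((a , b) ∷ ps) = clearPairs (clear X a b) ps

clear-⊆ : clear X a b ⊆ X
clear-⊆ = ⊆-trans remove-⊆ remove-⊆

clear-keeps-star : Avoids c (a , b) → star c ⊆ X → star c ⊆ clear X a b
clear-keeps-star {c = c} {a = a} {b = b} {X = X} (a≢c , b≢c) star⊆X = star⊆ λ v≢c →
  trans (remove-≢ (remove X a b) λ (c≡b , _) → b≢c (sym c≡b))
        (trans (remove-≢ X λ (c≡a , _) → a≢c (sym c≡a)) (⊆-arc star⊆X (star-arc v≢c)))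

clearPairs-⊆ : clearPairs X ps ⊆ X
clearPairs-⊆ {ps = []}    = ⊆-refl
clearPairs-⊆ {ps = _ ∷ ps} = ⊆-trans (clearPairs-⊆ {ps = ps}) clear-⊆

clearPairs-keeps-star : All (Avoids c) ps → star c ⊆ X → star c ⊆ clearPairs X ps
clearPairs-keeps-star []                 star⊆X = star⊆X
clearPairs-keeps-star (avoid ∷ avoids) star⊆X = clearPairs-keeps-star avoids (clear-keeps-star avoid star⊆X)

clearPairs-⇝ : InA' X → star c ⊆ X → All (Avoids c) ps → X ⇝[ length ps ] clearPairs X ps
clearPairs-⇝ inX star⊆X []                 = ≐⇒⇝ ≐-refl
clearPairs-⇝ {X = X} {c = c} {ps = (a , b) ∷ ps} inX@(_ , acyclic) star⊆X (avoid ∷ avoids) =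
  ⇝-trans (clear-move inX inX′) (clearPairs-⇝ inX′ star⊆X′ avoids)
  where
    star⊆X′ : star c ⊆ clear X a b
    star⊆X′ = clear-keeps-star avoid star⊆X
    inX′ : InA' (clear X a b)
    inX′ = star⊆⇒SimplyConnected star⊆X′ , Acyclic-antimono clear-⊆ acyclic

clearPairs-∈ : (a , b) ∈ ps ⊎ (b , a) ∈ ps → ¬ Arc (clearPairs X ps) a b
clearPairs-∈ {ps = (a , b) ∷ ps} {X = X} (inj₁ (here refl)) =
  ⊆-¬Arc (clearPairs-⊆ {ps = ps}) (⊆-¬Arc (remove-⊆ {X = remove X a b}) (remove-≡ X a b))
clearPairs-∈ {ps = (b , a) ∷ ps} {X = X} (inj₂ (here refl)) =
  ⊆-¬Arc (clearPairs-⊆ {ps = ps}) (remove-≡ (remove X b a) a b)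
clearPairs-∈ {ps = (x , y) ∷ _} {X = X} (inj₁ (there ab∈ps)) =
  clearPairs-∈ {X = clear X x y} (inj₁ ab∈ps)
clearPairs-∈ {ps = (x , y) ∷ _} {X = X} (inj₂ (there ba∈ps)) =
  clearPairs-∈ {X = clear X x y} (inj₂ ba∈ps)

recentre : InA' X → Source c X →
           All (_≢ c) vs → (∀ {v} → v ≢ c → Arc X c v ⊎ v ∈ vs) →
           All (Avoids c) ps → (∀ {a b} → a ≢ c → Arc X a b → (a , b) ∈ ps ⊎ (b , a) ∈ ps) →
           X ⇝[ length vs + length ps ] star c
recentre {X = X} {c = c} {vs = vs} {ps = ps} inX source vs≢c fan avoids cover =
  ⇝-respʳ (≐-star (clearPairs-keeps-star avoids star⊆X₁) leaves-c (proj₂ inX₂))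
          (⇝-trans fanning clearing)
  where
    X₁ X₂ : Digraph _
    X₁ = addOutArcs X c vs
    X₂ = clearPairs X₁ ps

    fanning : X ⇝[ length vs ] X₁
    fanning = addOutArcs-⇝ inX source vs≢c

    star⊆X₁ : star c ⊆ X₁
    star⊆X₁ = star⊆ λ v≢c →
      Sum.[ ⊆-arc (addOutArcs-⊇ {vs = vs}) , addOutArcs-∈ {X = X} {c = c} ]′ (fan v≢c)

    clearing : X₁ ⇝[ length ps ] X₂
    clearing = clearPairs-⇝ (⇝-target inX fanning) star⊆X₁ avoids

    inX₂ : InA' X₂
    inX₂ = ⇝-target (⇝-target inX fanning) clearing

    leaves-c : Arc X₂ a b → a ≡ c
    leaves-c {a = a} ab with a ≟ c
    ... | yes a≡c = a≡c
    ... | no a≢c  =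
      contradiction ab
        (clearPairs-∈ (cover a≢c (addOutArcs-≢ {vs = vs} a≢c (⊆-arc (clearPairs-⊆ {ps = ps}) ab))))

others : Fin (suc n) → List (Fin (suc n))
others {n} c = map (punchIn c) (allFin n)

others-≢ : (c : Fin (suc n)) → All (_≢ c) (others c)
others-≢ c = map⁺ (universal (punchInᵢ≢i c) _)

∈-others : {c v : Fin (suc n)} → v ≢ c → v ∈ others c
∈-others {c = c} v≢c =
  subst (_∈ others c) (punchIn-punchOut (v≢c ∘ sym)) (∈-map⁺ (punchIn c) (∈-allFin _))

length-others : (c : Fin (suc n)) → length (others c) ≡ n
length-others {n} c = trans (length-map (punchIn c) (allFin n)) (length-tabulate _)

pairs : ∀ n → List (Fin n × Fin n)
pairs zero    = []
pairs (suc n) = map (λ j → zero , suc j) (allFin n) List.++ map (λ (i , j) → suc i , suc j) (pairs n)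

pairs-complete : {i j : Fin n} → i ≢ j → (i , j) ∈ pairs n ⊎ (j , i) ∈ pairs n
pairs-complete {i = zero}  {j = zero}  i≢j = contradiction refl i≢j
pairs-complete {i = zero}  {j = suc j} _   = inj₁ (∈-++⁺ˡ (∈-map⁺ _ (∈-allFin j)))
pairs-complete {i = suc i} {j = zero}  _   = inj₂ (∈-++⁺ˡ (∈-map⁺ _ (∈-allFin i)))
pairs-complete {i = suc i} {j = suc j} i≢j =
  Sum.map (∈-++⁺ʳ _ ∘ ∈-map⁺ _) (∈-++⁺ʳ _ ∘ ∈-map⁺ _) (pairs-complete (i≢j ∘ cong suc))

length-pairs : ∀ n → 2 * length (pairs n) + n ≡ n * n
length-pairs zero    = refl
length-pairs (suc n) = begin
  2 * length (pairs (suc n)) + suc n ≡⟨ cong (λ t → 2 * t + suc n) length-suc ⟩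
  2 * (n + length (pairs n)) + suc n ≡⟨ regroup n (length (pairs n)) ⟩
  (2 * length (pairs n) + n) + (2 * n + 1) ≡⟨ cong (_+ (2 * n + 1)) (length-pairs n) ⟩
  n * n + (2 * n + 1) ≡⟨ square n ⟩
  suc n * suc n ∎
  where
    open ≡-Reasoning
    length-suc : length (pairs (suc n)) ≡ n + length (pairs n)
    length-suc = trans (length-++ (map (λ j → zero , suc j) (allFin n)))
                   (cong₂ _+_ (trans (length-map _ (allFin n)) (length-tabulate _)) (length-map _ (pairs n)))
    regroup : ∀ n t → 2 * (n + t) + suc n ≡ (2 * t + n) + (2 * n + 1)
    regroup = solve-∀
    square : ∀ n → n * n + (2 * n + 1) ≡ suc n * suc n
    square = solve-∀

pairsAvoiding : Fin (suc n) → List (Fin (suc n) × Fin (suc n))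
pairsAvoiding {n} c = map (Product.map (punchIn c) (punchIn c)) (pairs n)

pairsAvoiding-avoid : (c : Fin (suc n)) → All (Avoids c) (pairsAvoiding c)
pairsAvoiding-avoid c = map⁺ (universal (λ (i , j) → punchInᵢ≢i c i , punchInᵢ≢i c j) _)

pairsAvoiding-complete : {a b c : Fin (suc n)} → a ≢ c → b ≢ c → a ≢ b →
                         (a , b) ∈ pairsAvoiding c ⊎ (b , a) ∈ pairsAvoiding c
pairsAvoiding-complete {a = a} {b} {c} a≢c b≢c a≢b =
  subst₂ (λ x y → (x , y) ∈ pairsAvoiding c ⊎ (y , x) ∈ pairsAvoiding c)
         (punchIn-punchOut c≢a) (punchIn-punchOut c≢b)
         (Sum.map (∈-map⁺ _) (∈-map⁺ _) (pairs-complete (a≢b ∘ punchOut-injective c≢a c≢b)))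
  where
    c≢a : c ≢ a
    c≢a = a≢c ∘ sym
    c≢b : c ≢ b
    c≢b = b≢c ∘ sym

-- Joining two digraphs through out-stars

source⇝star : {X : Digraph (suc n)} → InA' X → Source c X → X ⇝[ n + length (pairs n) ] star c
source⇝star {n = n} {c = c} {X = X} inX@(_ , acyclic) source =
  subst₂ (λ k l → X ⇝[ k + l ] star c) (length-others c) (length-map _ (pairs n))
    (recentre inX source (others-≢ c) (inj₂ ∘ ∈-others) (pairsAvoiding-avoid c) cover)
  where
    cover : a ≢ c → Arc X a b → (a , b) ∈ pairsAvoiding c ⊎ (b , a) ∈ pairsAvoiding c
    cover a≢c ab =
      pairsAvoiding-complete a≢c (λ { refl → source _ ab }) (λ { refl → Acyclic⇒¬loop acyclic ab })

starFlip : Fin N → Fin N → Digraph N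
starFlip c d = add (remove (star c) c d) d c

module _ {c d : Fin N} (c≢d : c ≢ d) where

  private
    removed-arc⁻ : Arc (remove (star c) c d) a b → a ≡ c × b ≢ c × b ≢ d
    removed-arc⁻ {a = a} {b = b} ab
      with refl , b≢c ← star-arc⁻ {c = c} {a = a} (⊆-arc (remove-⊆ {X = star c}) {a = a} {b = b} ab)
      = refl , b≢c , λ { refl → remove-≡ (star c) c d ab }

  starFlip-arc⁻ : Arc (starFlip c d) a b → (a ≡ d × b ≡ c) ⊎ (a ≡ c × b ≢ c × b ≢ d)
  starFlip-arc⁻ {a = a} {b = b} ab with (a ≟ d) ×-dec (b ≟ c)
  ... | yes a≡d×b≡c = inj₁ a≡d×b≡c
  ... | no ne       = inj₂ (removed-arc⁻ (trans (sym (add-≢ (remove (star c) c d) ne)) ab))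

  starFlip-source : Source d (starFlip c d)
  starFlip-source a ad with starFlip-arc⁻ {a = a} ad
  ... | inj₁ (_ , d≡c)     = c≢d (sym d≡c)
  ... | inj₂ (_ , _ , d≢d) = d≢d refl

  starFlip-agrees : a ≢ d → Arc (starFlip c d) a b → Arc (star c) a b
  starFlip-agrees {a = a} a≢d ab with starFlip-arc⁻ {a = a} ab
  ... | inj₁ (a≡d , _)        = contradiction a≡d a≢d
  ... | inj₂ (refl , b≢c , _) = star-arc b≢c

  InA'-starFlip : InA' (starFlip c d)
  InA'-starFlip = hub⇒SimplyConnected hub , Acyclic-source-extension starFlip-source starFlip-agrees star-acyclic
    where
      kept : v ≢ c → v ≢ d → Arc (starFlip c d) c v
      kept {v = v} v≢c v≢d =
        trans (add-≢ (remove (star c) c d) ne₁) (trans (remove-≢ (star c) ne₂) (star-arc v≢c))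
        where
          ne₁ : ¬ (c ≡ d × v ≡ c)
          ne₁ (c≡d , _) = c≢d c≡d
          ne₂ : ¬ (c ≡ c × v ≡ d)
          ne₂ (_ , v≡d) = v≢d v≡d

      hub : v ≢ c → UAdj (starFlip c d) c v
      hub {v = v} v≢c =
        Sum.[ (λ { refl → inj₂ (add-≡ (remove (star c) c d) d c) }) , inj₁ ∘ kept v≢c ]′ (toSum (v ≟ d))

  star⇝starFlip : star c ⇝[ 1 ] starFlip c d
  star⇝starFlip = ⇝-single InA'-star InA'-starFlip
    (c , d , inj₂ (inj₁ (star-arc (c≢d ∘ sym) , disconnecting , ≐-refl)))
    where
      disconnecting : Disconnecting (star c) c d
      disconnecting = isolated⇒¬SimplyConnected
        (λ a ad → proj₂ (proj₂ (removed-arc⁻ {a = a} ad)) refl)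
        (λ b db → c≢d (sym (proj₁ (removed-arc⁻ {a = d} {b = b} db))))
        c≢d

star⇝star : {m : ℕ} (c d : Fin (suc (suc m))) → star c ⇝[ 1 + (m + m) ] star d
star⇝star {m} c d with c ≟ d
... | yes refl = ≐⇒⇝ ≐-refl
... | no c≢d   = ⇝-trans (star⇝starFlip c≢d)
  (subst₂ (λ k l → starFlip c d ⇝[ k + l ] star d) length-rest (trans (length-map (c ,_) rest) length-rest)
    (recentre (InA'-starFlip c≢d) (starFlip-source c≢d) rest-≢ fan avoids cover))
  where
    d≢c : d ≢ c
    d≢c = c≢d ∘ sym

    -- the m vertices other than c and d
    rest : List (Fin (suc (suc m)))
    rest = map (punchIn d) (others (punchOut d≢c))

    rest-≢ : All (_≢ d) rest
    rest-≢ = map⁺ (universal (punchInᵢ≢i d) _)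

    ∈-rest : v ≢ d → v ≢ c → v ∈ rest
    ∈-rest v≢d v≢c = subst (_∈ rest) (punchIn-punchOut (v≢d ∘ sym))
      (∈-map⁺ (punchIn d) (∈-others (v≢c ∘ punchOut-injective (v≢d ∘ sym) d≢c)))

    length-rest : length rest ≡ m
    length-rest = trans (length-map (punchIn d) (others (punchOut d≢c))) (length-others (punchOut d≢c))

    fan : v ≢ d → Arc (starFlip c d) d v ⊎ v ∈ rest
    fan {v = v} v≢d =
      Sum.[ (λ { refl → inj₁ (add-≡ (remove (star c) c d) d c) }) , inj₂ ∘ ∈-rest v≢d ]′ (toSum (v ≟ c))

    avoids : All (Avoids d) (map (c ,_) rest)
    avoids = map⁺ (All.map (c≢d ,_) rest-≢)

    cover : a ≢ d → Arc (starFlip c d) a b → (a , b) ∈ map (c ,_) rest ⊎ (b , a) ∈ map (c ,_) rest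
    cover {a = a} a≢d ab with starFlip-arc⁻ c≢d {a = a} ab
    ... | inj₁ (a≡d , _)          = contradiction a≡d a≢d
    ... | inj₂ (refl , b≢c , b≢d) = inj₁ (∈-map⁺ (c ,_) (∈-rest b≢d b≢c))

steps-bound : ∀ m t → 2 * t + suc m ≡ suc m * suc m →
              2 * ((suc m + t) + ((1 + (m + m)) + (suc m + t))) ≤ (suc (suc m) + 7) * (2 * suc (suc m) ∸ 3)
steps-bound m t 2t+n≡n² = begin
  2 * ((suc m + t) + ((1 + (m + m)) + (suc m + t))) ≡⟨ regroup m t ⟩
  2 * (2 * t + suc m) + (6 * m + 4)                   ≡⟨ cong (λ s → 2 * s + (6 * m + 4)) 2t+n≡n² ⟩
  2 * (suc m * suc m) + (6 * m + 4)                   ≤⟨ m≤m+n _ (9 * m + 3) ⟩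
  2 * (suc m * suc m) + (6 * m + 4) + (9 * m + 3)     ≡⟨ factor m ⟩
  (suc (suc m) + 7) * (2 * m + 1)                     ≡⟨ cong ((suc (suc m) + 7) *_) (sym 2N∸3) ⟩
  (suc (suc m) + 7) * (2 * suc (suc m) ∸ 3)           ∎
  where
    open ≤-Reasoning
    regroup : ∀ m t → 2 * ((suc m + t) + ((1 + (m + m)) + (suc m + t))) ≡ 2 * (2 * t + suc m) + (6 * m + 4)
    regroup = solve-∀
    factor : ∀ m → 2 * (suc m * suc m) + (6 * m + 4) + (9 * m + 3) ≡ (suc (suc m) + 7) * (2 * m + 1)
    factor = solve-∀
    2N≡3+[2m+1] : ∀ m → 2 * suc (suc m) ≡ 3 + (2 * m + 1)
    2N≡3+[2m+1] = solve-∀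
    2N∸3 : 2 * suc (suc m) ∸ 3 ≡ 2 * m + 1
    2N∸3 = trans (cong (_∸ 3) (2N≡3+[2m+1] m)) (m+n∸m≡n 3 (2 * m + 1))

theorem1 : (N : ℕ) → 2 ≤ N → (G H : Digraph N) → InA' G → InA' H →
    ∃[ p ] (1 ≤ p × 2 * p ≤ (N + 7) * (2 * N ∸ 3) × Reach p G H)
theorem1 (suc (suc m)) (s≤s (s≤s z≤n)) G H inG inH =
  let c , sourceG = acyclic⇒source zero (proj₂ inG)
      d , sourceH = acyclic⇒source zero (proj₂ inH)
      G⇝H = ⇝-trans (source⇝star inG sourceG)
              (⇝-trans (star⇝star c d) (⇝-sym (source⇝star inH sourceH)))
      p , 1≤p , p≤K , reach = ⇝⇒Reach zero inG (s≤s z≤n) G⇝H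
  in p , 1≤p , ≤-trans (*-monoʳ-≤ 2 p≤K) (steps-bound m _ (length-pairs (suc m))) , reach
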